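{- For $n\geqslant 0$, $$\sum_{j=0}^{\infty}D_1\!\left(\frac{n-j(j+1)/2}{2}\right)=D_2^*(n).$$
   Context: For a non-negative integer $m$, $D_1(m)$ is the number of partitions of $m$ into distinct parts (so $D_1(0)=1$); $D_1(x)=0$ if $x$ is not a non-negative integer. $D_2^*(n)$ is the number of partitions of $n$ into distinct parts using two colors $0$ and $1$ (no colored part, i.e. value together with color, repeated) such that (i) the parts of color $0$ form a gap-free partition, i.e. they are exactly $1,2,\dots,j$ for some $j\geqslant 0$, and (ii) only even parts can have color $1$. -}

module Defs where

open import Data.Bool using (Bool; true; false; _∧_; if_then_else_)
open import Data.Nat using (ℕ; zero; suc; _+_; _*_; _∸_; _/_; _%_; _≡ᵇ_; _≤ᵇ_)
open import Data.Nat.Properties using (_≟_)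
open import Data.Product using (_×_; _,_; proj₁; proj₂)
open import Data.List using (List; []; _∷_; [_]; _++_; map; length; filterᵇ; applyUpTo; concatMap)
open import Data.Nat.ListAction using (sum)
open import Data.Bool.ListAction using (all)
open import Data.List.Properties using (≡-dec)
open import Relation.Nullary using (does)

sublists : {A : Set} → List A → List (List A)
sublists []       = [ [] ]
sublists (x ∷ xs) = map (x ∷_) (sublists xs) ++ sublists xs

-- D₁ m : number of partitions of m into distinct parts,
-- i.e. number of subsets of {1,…,m} whose elements sum to m  (D₁ 0 = 1)
D₁ : ℕ → ℕ
D₁ m = length (filterᵇ (λ s → sum s ≡ᵇ m) (sublists (applyUpTo suc m)))

tri : ℕ → ℕ
tri j = (j * suc j) / 2

-- the j-th summand  D₁((n - j(j+1)/2)/2), which is 0 unless the argument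
-- is a non-negative integer
term : ℕ → ℕ → ℕ
term n j =
  if (tri j ≤ᵇ n) ∧ ((n ∸ tri j) % 2 ≡ᵇ 0)
  then D₁ ((n ∸ tri j) / 2)
  else 0

partialSum : ℕ → ℕ → ℕ
partialSum n N = sum (map (term n) (applyUpTo (λ j → j) N))

-- colored parts: (value , color), color ∈ {0,1}
ColoredPart : Set
ColoredPart = ℕ × ℕ

coloredParts : ℕ → List ColoredPart
coloredParts n = concatMap (λ v → (v , 0) ∷ (v , 1) ∷ []) (applyUpTo suc n)

isEvenᵇ : ℕ → Bool
isEvenᵇ v = v % 2 ≡ᵇ 0

colorZeroValues : List ColoredPart → List ℕ
colorZeroValues [] = []
colorZeroValues ((v , zero) ∷ ps) = v ∷ colorZeroValues ps
colorZeroValues ((v , suc _) ∷ ps) = colorZeroValues ps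

color1Even : List ColoredPart → Bool
color1Even = all (λ p → if proj₂ p ≡ᵇ 1 then isEvenᵇ (proj₁ p) else true)

-- condition (i): the color-0 parts (listed increasingly) are exactly 1,2,…,j for some j
-- (necessarily j = their number)
gapFree : List ℕ → Bool
gapFree vs = does (≡-dec _≟_ vs (applyUpTo suc (length vs)))

-- D₂* n : partitions of n into distinct colored parts (a set of colored parts,
-- no colored part repeated) satisfying (i) and (ii)
isD₂*ᵇ : ℕ → List ColoredPart → Bool
isD₂*ᵇ n ps = (sum (map proj₁ ps) ≡ᵇ n) ∧ gapFree (colorZeroValues ps) ∧ color1Even ps

D₂* : ℕ → ℕ
D₂* n = length (filterᵇ (isD₂*ᵇ n) (sublists (coloredParts n)))

module Submission where

open import Defs
open import Data.Nat using (ℕ; _<_)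
open import Relation.Binary.PropositionalEquality using (_≡_)

-- A colored partition counted by D₂*(n) is the same as a pair (A, B) of subsets of
-- {1,…,n}: A is the set of its color-0 values and B the set of its color-1 values
-- (lemma color-split).  Condition (i) says that A = {1,…,j} for some j, so summing over
-- the admissible A is summing over j (lemma sum-over-runs), and A contributes the
-- triangular number j(j+1)/2 = tri j.  Condition (ii) says that B consists of even
-- numbers; halving B turns it into a partition of (n − tri j)/2 into distinct parts
-- (lemma even-parts-count), and parts larger than that target never occur
-- (lemma D₁-stable), so the j-th fibre is exactly the summand  term n j  (lemma run-fibre).
-- Finally the summands with j > n vanish because tri j ≥ j (lemma term-beyond).

open import Data.Bool using (Bool; true; false; _∧_; if_then_else_)
open import Data.Bool.Properties using (∧-assoc; ∧-comm)
open import Data.Bool.ListAction using (all)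
open import Data.List
  using (List; []; _∷_; [_]; _++_; _∷ʳ_; map; length; filterᵇ; applyUpTo; concatMap)
open import Data.List.Properties
  using (map-++; map-∘; map-cong; map-applyUpTo; applyUpTo-∷ʳ; length-applyUpTo;
         length-++; filter-++; ++-identityʳ; ≡-dec; ∷-injectiveˡ)
open import Data.List.Relation.Unary.All as All using (All; []; _∷_; universal)
open import Data.List.Relation.Unary.All.Properties using (++⁺; map⁺; applyUpTo⁺₁)
open import Data.Nat using (suc; zero; _+_; _*_; _∸_; _/_; _%_; _≡ᵇ_; _≤ᵇ_; _≤_; z≤n; s≤s)
open import Data.Nat.DivMod using (m≡m%n+[m/n]*n; m%n<n; m*n%n≡0; m*n/n≡m; [m+kn]%n≡m%n; /-monoˡ-≤)
open import Data.Nat.ListAction using (sum)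
open import Data.Nat.ListAction.Properties using (sum-++)
open import Data.Nat.Properties
  using (_≟_; _≤?_; suc-injective; 1+n≢0; +-assoc; +-comm; +-identityʳ; *-comm;
         *-distribˡ-+; *-distribʳ-+; +-mono-≤; m≤m+n; m≤n+m; m∸n≤m; m+n∸m≡n; m+[n∸m]≡n;
         <-≤-trans; <⇒≱; <⇒≢; +-commutativeSemigroup)
open import Algebra.Properties.CommutativeSemigroup +-commutativeSemigroup
  using (interchange; x∙yz≈y∙xz)
open import Data.Product using (_×_; _,_; proj₁; proj₂)
open import Function using (_∘_)
open import Function.Definitions using (Injective)
open import Relation.Nullary using (does)
open import Relation.Nullary.Decidable using (dec-true; dec-false; does-≡; map′; _×-dec_; T?)
open import Relation.Binary.PropositionalEquality
  using (_≢_; refl; sym; trans; cong; cong₂; subst; subst₂; module ≡-Reasoning)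

open ≡-Reasoning

private
  variable
    A B : Set


tally : (A → Bool) → List A → ℕ
tally p xs = length (filterᵇ p xs)

tally-++ : (p : A → Bool) (xs ys : List A) → tally p (xs ++ ys) ≡ tally p xs + tally p ys
tally-++ p xs ys = trans (cong length (filter-++ (T? ∘ p) xs ys)) (length-++ (filterᵇ p xs))

tally-map : (p : B → Bool) (f : A → B) (xs : List A) → tally p (map f xs) ≡ tally (p ∘ f) xs
tally-map p f [] = refl
tally-map p f (x ∷ xs) with p (f x)
... | true  = cong suc (tally-map p f xs)
... | false = tally-map p f xs

tally-cong : {p q : A → Bool} {xs : List A} → All (λ x → p x ≡ q x) xs → tally p xs ≡ tally q xs
tally-cong [] = refl
tally-cong {p = p} {q} {x ∷ xs} (px≡qx ∷ rest) with p x | q x | px≡qx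
... | true  | true  | _  = cong suc (tally-cong rest)
... | false | false | _  = tally-cong rest
... | true  | false | ()
... | false | true  | ()

tally-none : {p : A → Bool} (xs : List A) → (∀ x → p x ≡ false) → tally p xs ≡ 0
tally-none [] never = refl
tally-none {p = p} (x ∷ xs) never with p x | never x
... | false | _  = tally-none xs never
... | true  | ()

tally-guard : (c : Bool) (q : A → Bool) (xs : List A) →
              tally (λ x → c ∧ q x) xs ≡ (if c then tally q xs else 0)
tally-guard true  q xs = refl
tally-guard false q xs = tally-none xs (λ _ → refl)

count : (List A → Bool) → List A → ℕ
count p L = tally p (sublists L)

-- a sublist of x ∷ L either contains x or is a sublist of L
count-∷ : (p : List A → Bool) (x : A) (L : List A) →
          count p (x ∷ L) ≡ count (λ s → p (x ∷ s)) L + count p L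
count-∷ p x L =
  trans (tally-++ p (map (x ∷_) (sublists L)) (sublists L))
        (cong (_+ count p L) (tally-map p (x ∷_) (sublists L)))

sublists-All : {P : A → Set} {L : List A} → All P L → All (All P) (sublists L)
sublists-All []         = [] ∷ []
sublists-All (px ∷ pxs) =
  ++⁺ (map⁺ (All.map (px ∷_) (sublists-All pxs))) (sublists-All pxs)

sublists-map : (f : A → B) (L : List A) → sublists (map f L) ≡ map (map f) (sublists L)
sublists-map f [] = refl
sublists-map {A = A} f (x ∷ L) = begin
    map (f x ∷_) (sublists (map f L)) ++ sublists (map f L)
  ≡⟨ cong (λ T → map (f x ∷_) T ++ T) (sublists-map f L) ⟩
    map (f x ∷_) (map (map f) S) ++ map (map f) S
  ≡⟨ cong (_++ map (map f) S) (trans (sym (map-∘ S)) (map-∘ S)) ⟩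
    map (map f) (map (x ∷_) S) ++ map (map f) S
  ≡⟨ sym (map-++ (map f) (map (x ∷_) S) S) ⟩
    map (map f) (sublists (x ∷ L)) ∎
  where
  S : List (List A)
  S = sublists L

count-map : (p : List B → Bool) (f : A → B) (L : List A) →
            count p (map f L) ≡ count (p ∘ map f) L
count-map p f L = trans (cong (tally p) (sublists-map f L)) (tally-map p (map f) (sublists L))

count-filter : (q : A → Bool) (p : List A → Bool) (L : List A) →
               count (λ s → all q s ∧ p s) L ≡ count p (filterᵇ q L)
count-filter q p [] with p []
... | true  = refl
... | false = refl
count-filter q p (x ∷ L) with q x in qx
... | true  = begin
    count (λ s → all q s ∧ p s) (x ∷ L)
  ≡⟨ count-∷ (λ s → all q s ∧ p s) x L ⟩
    count (λ s → (q x ∧ all q s) ∧ p (x ∷ s)) L + count (λ s → all q s ∧ p s) L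
  ≡⟨ cong (λ b → count (λ s → (b ∧ all q s) ∧ p (x ∷ s)) L + count (λ s → all q s ∧ p s) L) qx ⟩
    count (λ s → all q s ∧ p (x ∷ s)) L + count (λ s → all q s ∧ p s) L
  ≡⟨ cong₂ _+_ (count-filter q (λ s → p (x ∷ s)) L) (count-filter q p L) ⟩
    count (λ s → p (x ∷ s)) (filterᵇ q L) + count p (filterᵇ q L)
  ≡⟨ sym (count-∷ p x (filterᵇ q L)) ⟩
    count p (x ∷ filterᵇ q L) ∎
... | false = begin
    count (λ s → all q s ∧ p s) (x ∷ L)
  ≡⟨ count-∷ (λ s → all q s ∧ p s) x L ⟩
    count (λ s → (q x ∧ all q s) ∧ p (x ∷ s)) L + count (λ s → all q s ∧ p s) L
  ≡⟨ cong₂ _+_ (tally-none (sublists L) (λ s → cong (λ b → (b ∧ all q s) ∧ p (x ∷ s)) qx))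
               (count-filter q p L) ⟩
    count p (filterᵇ q L) ∎

sum-zero : {xs : List ℕ} → All (_≡ 0) xs → sum xs ≡ 0
sum-zero []             = refl
sum-zero (refl ∷ zeros) = sum-zero zeros

sum-map-+ : (f g : A → ℕ) (xs : List A) →
            sum (map (λ x → f x + g x) xs) ≡ sum (map f xs) + sum (map g xs)
sum-map-+ f g [] = refl
sum-map-+ f g (x ∷ xs) =
  trans (cong (f x + g x +_) (sum-map-+ f g xs)) (interchange (f x) (g x) _ _)

sum-map-*ʳ : (k : ℕ) (xs : List ℕ) → sum (map (_* k) xs) ≡ sum xs * k
sum-map-*ʳ k [] = refl
sum-map-*ʳ k (x ∷ xs) = trans (cong (x * k +_) (sum-map-*ʳ k xs)) (sym (*-distribʳ-+ k x (sum xs)))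

sum-∷ʳ : (xs : List ℕ) (x : ℕ) → sum (xs ∷ʳ x) ≡ sum xs + x
sum-∷ʳ xs x = trans (sum-++ xs [ x ]) (cong (sum xs +_) (+-identityʳ x))

length≤sum : {xs : List ℕ} → All (0 <_) xs → length xs ≤ sum xs
length≤sum []           = z≤n
length≤sum (pos ∷ rest) = +-mono-≤ pos (length≤sum rest)

applyUpTo-cong : {f g : ℕ → A} → (∀ i → f i ≡ g i) → (k : ℕ) → applyUpTo f k ≡ applyUpTo g k
applyUpTo-cong f≡g zero    = refl
applyUpTo-cong f≡g (suc k) = cong₂ _∷_ (f≡g 0) (applyUpTo-cong (f≡g ∘ suc) k)

applyUpTo-+ : (f : ℕ → A) (a b : ℕ) →
              applyUpTo f (a + b) ≡ applyUpTo f a ++ applyUpTo (λ i → f (a + i)) b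
applyUpTo-+ f zero    b = refl
applyUpTo-+ f (suc a) b = cong (f 0 ∷_) (applyUpTo-+ (f ∘ suc) a b)

sum-applyUpTo-truncate : (g : ℕ → ℕ) {M N : ℕ} → M ≤ N → (∀ j → M ≤ j → g j ≡ 0) →
                         sum (applyUpTo g N) ≡ sum (applyUpTo g M)
sum-applyUpTo-truncate g {N = N} z≤n vanish = sum-zero (applyUpTo⁺₁ g N (λ {i} _ → vanish i z≤n))
sum-applyUpTo-truncate g (s≤s M≤N) vanish =
  cong (g 0 +_) (sum-applyUpTo-truncate (g ∘ suc) M≤N (λ j M≤j → vanish (suc j) (s≤s M≤j)))

Σsub : (List A → ℕ) → List A → ℕ
Σsub w L = sum (map w (sublists L))

Σsub-∷ : (w : List A → ℕ) (x : A) (L : List A) →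
         Σsub w (x ∷ L) ≡ Σsub (λ s → w (x ∷ s)) L + Σsub w L
Σsub-∷ {A = A} w x L = begin
    sum (map w (map (x ∷_) S ++ S))
  ≡⟨ cong sum (map-++ w (map (x ∷_) S) S) ⟩
    sum (map w (map (x ∷_) S) ++ map w S)
  ≡⟨ sum-++ (map w (map (x ∷_) S)) (map w S) ⟩
    sum (map w (map (x ∷_) S)) + Σsub w L
  ≡⟨ cong (λ ys → sum ys + Σsub w L) (sym (map-∘ S)) ⟩
    Σsub (λ s → w (x ∷ s)) L + Σsub w L ∎
  where
  S : List (List A)
  S = sublists L

Σsub-cong : {w w′ : List A → ℕ} → (∀ s → w s ≡ w′ s) → (L : List A) → Σsub w L ≡ Σsub w′ L
Σsub-cong w≡w′ L = cong sum (map-cong w≡w′ (sublists L))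

Σsub-only-[] : {P : A → Set} {L : List A} (w : List A → ℕ) → All P L →
               (∀ {x} s → P x → w (x ∷ s) ≡ 0) → Σsub w L ≡ w []
Σsub-only-[] w [] vanish = +-identityʳ (w [])
Σsub-only-[] {L = x ∷ L} w (px ∷ pxs) vanish =
  trans (Σsub-∷ w x L)
        (cong₂ _+_ (sum-zero (map⁺ (universal (λ s → vanish s px) (sublists L))))
                   (Σsub-only-[] w pxs vanish))

-- Splitting a two-colored partition into its two color classes

colorOneValues : List ColoredPart → List ℕ
colorOneValues [] = []
colorOneValues ((v , zero)  ∷ ps) = colorOneValues ps
colorOneValues ((v , suc _) ∷ ps) = v ∷ colorOneValues ps

twoColored : List ℕ → List ColoredPart
twoColored = concatMap (λ v → (v , 0) ∷ (v , 1) ∷ [])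

-- a sublist of  twoColored vs  is a pair of sublists of vs (its two color classes)
color-split : (P : List ℕ → List ℕ → Bool) (vs : List ℕ) →
              count (λ s → P (colorZeroValues s) (colorOneValues s)) (twoColored vs)
              ≡ Σsub (λ A → count (P A) vs) vs
color-split P [] with P [] []
... | true  = refl
... | false = refl
color-split P (v ∷ vs) = begin
    count (byColor P) ((v , 0) ∷ (v , 1) ∷ L)
  ≡⟨ count-∷ (byColor P) (v , 0) ((v , 1) ∷ L) ⟩
    count (byColor P₀) ((v , 1) ∷ L) + count (byColor P) ((v , 1) ∷ L)
  ≡⟨ cong₂ _+_ (count-∷ (byColor P₀) (v , 1) L) (count-∷ (byColor P) (v , 1) L) ⟩
    (count (byColor P₀₁) L + count (byColor P₀) L) + (count (byColor P₁) L + count (byColor P) L)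
  ≡⟨ cong₂ _+_ (cong₂ _+_ (color-split P₀₁ vs) (color-split P₀ vs))
               (cong₂ _+_ (color-split P₁ vs) (color-split P vs)) ⟩
    (Σsub (λ A → count (P₀₁ A) vs) vs + Σsub (λ A → count (P₀ A) vs) vs)
      + (Σsub (λ A → count (P₁ A) vs) vs + Σsub (λ A → count (P A) vs) vs)
  ≡⟨ cong₂ _+_ (sym (sum-map-+ (λ A → count (P₀₁ A) vs) (λ A → count (P₀ A) vs) S))
               (sym (sum-map-+ (λ A → count (P₁ A) vs) (λ A → count (P A) vs) S)) ⟩
    Σsub (λ A → count (P₀₁ A) vs + count (P₀ A) vs) vs
      + Σsub (λ A → count (P₁ A) vs + count (P A) vs) vs
  ≡⟨ cong₂ _+_ (Σsub-cong (λ A → sym (count-∷ (P₀ A) v vs)) vs)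
               (Σsub-cong (λ A → sym (count-∷ (P A) v vs)) vs) ⟩
    Σsub (λ A → count (P (v ∷ A)) (v ∷ vs)) vs + Σsub (λ A → count (P A) (v ∷ vs)) vs
  ≡⟨ sym (Σsub-∷ (λ A → count (P A) (v ∷ vs)) v vs) ⟩
    Σsub (λ A → count (P A) (v ∷ vs)) (v ∷ vs) ∎
  where
  L : List ColoredPart
  L = twoColored vs
  S : List (List ℕ)
  S = sublists vs
  byColor : (List ℕ → List ℕ → Bool) → List ColoredPart → Bool
  byColor Q s = Q (colorZeroValues s) (colorOneValues s)
  P₀ P₁ P₀₁ : List ℕ → List ℕ → Bool
  P₀  Z O = P (v ∷ Z) O
  P₁  Z O = P Z (v ∷ O)
  P₀₁ Z O = P (v ∷ Z) (v ∷ O)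

-- Summing over gap-free sublists

-- isRun f A : A is the initial run  f 0, f 1, …, f (length A − 1);
-- in particular  gapFree = isRun suc
isRun : (ℕ → ℕ) → List ℕ → Bool
isRun f A = does (≡-dec _≟_ A (applyUpTo f (length A)))

isRun-head : (f : ℕ → ℕ) (A : List ℕ) → isRun f (f 0 ∷ A) ≡ isRun (f ∘ suc) A
isRun-head f A rewrite dec-true (f 0 ≟ f 0) refl = refl

isRun-other : (f : ℕ → ℕ) {x : ℕ} (A : List ℕ) → x ≢ f 0 → isRun f (x ∷ A) ≡ false
isRun-other f {x} A x≢f0 =
  dec-false (≡-dec _≟_ (x ∷ A) (applyUpTo f (suc (length A)))) (x≢f0 ∘ ∷-injectiveˡ)

-- for injective f, the runs among the sublists of  f 0, …, f (k − 1)  are exactly the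
-- prefixes  applyUpTo f j,  j ≤ k, each occurring once
sum-over-runs : (f : ℕ → ℕ) → Injective _≡_ _≡_ f → (h : List ℕ → ℕ) (k : ℕ) →
                Σsub (λ A → if isRun f A then h A else 0) (applyUpTo f k)
                ≡ sum (applyUpTo (λ j → h (applyUpTo f j)) (suc k))
sum-over-runs f inj h zero = refl
sum-over-runs f inj h (suc k) = begin
    Σsub w (f 0 ∷ L)
  ≡⟨ Σsub-∷ w (f 0) L ⟩
    Σsub (λ A → w (f 0 ∷ A)) L + Σsub w L
  ≡⟨ cong₂ _+_ (Σsub-cong (λ A → cong (λ b → if b then h (f 0 ∷ A) else 0) (isRun-head f A)) L)
               (Σsub-only-[] w notHead (λ A x≢f0 → cong (λ b → if b then h _ else 0)
                                                         (isRun-other f A x≢f0))) ⟩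
    Σsub (λ A → if isRun (f ∘ suc) A then h (f 0 ∷ A) else 0) L + h []
  ≡⟨ cong (_+ h []) (sum-over-runs (f ∘ suc) (λ eq → suc-injective (inj eq)) (λ A → h (f 0 ∷ A)) k) ⟩
    sum (applyUpTo (λ j → h (applyUpTo f (suc j))) (suc k)) + h []
  ≡⟨ +-comm _ (h []) ⟩
    sum (applyUpTo (λ j → h (applyUpTo f j)) (suc (suc k))) ∎
  where
  w : List ℕ → ℕ
  w A = if isRun f A then h A else 0
  L : List ℕ
  L = applyUpTo (f ∘ suc) k
  notHead : All (_≢ f 0) L
  notHead = applyUpTo⁺₁ (f ∘ suc) k (λ _ eq → 1+n≢0 (inj eq))

offset-test : (t y m : ℕ) → (t + y ≡ᵇ m) ≡ (t ≤ᵇ m) ∧ (y ≡ᵇ m ∸ t)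
offset-test t y m = does-≡ (t + y ≟ m) (map′ join split ((t ≤? m) ×-dec (y ≟ m ∸ t)))
  where
  split : t + y ≡ m → t ≤ m × y ≡ m ∸ t
  split refl = m≤m+n t y , sym (m+n∸m≡n t y)
  join : t ≤ m × y ≡ m ∸ t → t + y ≡ m
  join (t≤m , refl) = m+[n∸m]≡n t≤m

halve-test : (x d : ℕ) → (x * 2 ≡ᵇ d) ≡ (d % 2 ≡ᵇ 0) ∧ (x ≡ᵇ d / 2)
halve-test x d = does-≡ (x * 2 ≟ d) (map′ join split ((d % 2 ≟ 0) ×-dec (x ≟ d / 2)))
  where
  split : x * 2 ≡ d → d % 2 ≡ 0 × x ≡ d / 2
  split refl = m*n%n≡0 x 2 , sym (m*n/n≡m x 2)
  join : d % 2 ≡ 0 × x ≡ d / 2 → x * 2 ≡ d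
  join (d-even , refl) = sym (trans (m≡m%n+[m/n]*n d 2) (cong (_+ d / 2 * 2) d-even))

double-offset-test : (t x m : ℕ) →
  (t + x * 2 ≡ᵇ m) ≡ ((t ≤ᵇ m) ∧ ((m ∸ t) % 2 ≡ᵇ 0)) ∧ (x ≡ᵇ (m ∸ t) / 2)
double-offset-test t x m =
  trans (offset-test t (x * 2) m)
        (trans (cong ((t ≤ᵇ m) ∧_) (halve-test x (m ∸ t))) (sym (∧-assoc (t ≤ᵇ m) _ _)))

isEven-odd : (q : ℕ) → isEvenᵇ (suc (q * 2)) ≡ false
isEven-odd q = cong (_≡ᵇ 0) ([m+kn]%n≡m%n 1 q 2)

isEven-double : (q : ℕ) → isEvenᵇ (q * 2) ≡ true
isEven-double q = cong (_≡ᵇ 0) (m*n%n≡0 q 2)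

filterᵇ-∷ʳ : (p : A → Bool) (xs : List A) (x : A) →
             filterᵇ p (xs ∷ʳ x) ≡ filterᵇ p xs ++ (if p x then [ x ] else [])
filterᵇ-∷ʳ p xs x = trans (filter-++ (T? ∘ p) xs [ x ]) (cong (filterᵇ p xs ++_) singleton)
  where
  singleton : filterᵇ p [ x ] ≡ (if p x then [ x ] else [])
  singleton with p x
  ... | true  = refl
  ... | false = refl

evens-upTo-odd : (q : ℕ) →
  filterᵇ isEvenᵇ (applyUpTo suc (suc (q * 2))) ≡ filterᵇ isEvenᵇ (applyUpTo suc (q * 2))
evens-upTo-odd q = begin
    filterᵇ isEvenᵇ (applyUpTo suc (suc (q * 2)))
  ≡⟨ cong (filterᵇ isEvenᵇ) (sym (applyUpTo-∷ʳ suc (q * 2))) ⟩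
    filterᵇ isEvenᵇ (U ∷ʳ suc (q * 2))
  ≡⟨ filterᵇ-∷ʳ isEvenᵇ U (suc (q * 2)) ⟩
    filterᵇ isEvenᵇ U ++ (if isEvenᵇ (suc (q * 2)) then [ suc (q * 2) ] else [])
  ≡⟨ cong (λ b → filterᵇ isEvenᵇ U ++ (if b then [ suc (q * 2) ] else [])) (isEven-odd q) ⟩
    filterᵇ isEvenᵇ U ++ []
  ≡⟨ ++-identityʳ (filterᵇ isEvenᵇ U) ⟩
    filterᵇ isEvenᵇ U ∎
  where
  U : List ℕ
  U = applyUpTo suc (q * 2)

evens-upTo-double : (q : ℕ) → filterᵇ isEvenᵇ (applyUpTo suc (q * 2)) ≡ map (_* 2) (applyUpTo suc q)
evens-upTo-double zero = refl
evens-upTo-double (suc q) = begin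
    filterᵇ isEvenᵇ (applyUpTo suc (suc (suc (q * 2))))
  ≡⟨ cong (filterᵇ isEvenᵇ) (sym (applyUpTo-∷ʳ suc (suc (q * 2)))) ⟩
    filterᵇ isEvenᵇ (applyUpTo suc (suc (q * 2)) ∷ʳ suc q * 2)
  ≡⟨ filterᵇ-∷ʳ isEvenᵇ (applyUpTo suc (suc (q * 2))) (suc q * 2) ⟩
    filterᵇ isEvenᵇ (applyUpTo suc (suc (q * 2))) ++ (if isEvenᵇ (suc q * 2) then [ suc q * 2 ] else [])
  ≡⟨ cong₂ (λ E b → E ++ (if b then [ suc q * 2 ] else []))
           (trans (evens-upTo-odd q) (evens-upTo-double q)) (isEven-double (suc q)) ⟩
    map (_* 2) (applyUpTo suc q) ++ map (_* 2) [ suc q ]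
  ≡⟨ sym (map-++ (_* 2) (applyUpTo suc q) [ suc q ]) ⟩
    map (_* 2) (applyUpTo suc q ∷ʳ suc q)
  ≡⟨ cong (map (_* 2)) (applyUpTo-∷ʳ suc q) ⟩
    map (_* 2) (applyUpTo suc (suc q)) ∎

-- writing K = r + 2⌊K/2⌋ with r < 2 reduces to the two cases above
evens-upTo : (K : ℕ) → filterᵇ isEvenᵇ (applyUpTo suc K) ≡ map (_* 2) (applyUpTo suc (K / 2))
evens-upTo K =
  subst (λ M → filterᵇ isEvenᵇ (applyUpTo suc M) ≡ map (_* 2) (applyUpTo suc (K / 2)))
        (sym (m≡m%n+[m/n]*n K 2)) (byRemainder (K % 2) (m%n<n K 2))
  where
  byRemainder : (r : ℕ) → r < 2 →
    filterᵇ isEvenᵇ (applyUpTo suc (r + K / 2 * 2)) ≡ map (_* 2) (applyUpTo suc (K / 2))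
  byRemainder 0 _ = evens-upTo-double (K / 2)
  byRemainder 1 _ = trans (evens-upTo-odd (K / 2)) (evens-upTo-double (K / 2))
  byRemainder (suc (suc _)) (s≤s (s≤s ()))

-- Counting partitions into distinct parts

-- all-even sublists of 1, …, K with  t + (their sum) = m,  counted by halving the parts
even-parts-count : (K t m : ℕ) →
  count (λ B → all isEvenᵇ B ∧ (t + sum B ≡ᵇ m)) (applyUpTo suc K)
  ≡ (if (t ≤ᵇ m) ∧ ((m ∸ t) % 2 ≡ᵇ 0)
     then count (λ B → sum B ≡ᵇ (m ∸ t) / 2) (applyUpTo suc (K / 2)) else 0)
even-parts-count K t m = begin
    count (λ B → all isEvenᵇ B ∧ (t + sum B ≡ᵇ m)) (applyUpTo suc K)
  ≡⟨ count-filter isEvenᵇ (λ B → t + sum B ≡ᵇ m) (applyUpTo suc K) ⟩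
    count (λ B → t + sum B ≡ᵇ m) (filterᵇ isEvenᵇ (applyUpTo suc K))
  ≡⟨ cong (count (λ B → t + sum B ≡ᵇ m)) (evens-upTo K) ⟩
    count (λ B → t + sum B ≡ᵇ m) (map (_* 2) H)
  ≡⟨ count-map (λ B → t + sum B ≡ᵇ m) (_* 2) H ⟩
    count (λ B → t + sum (map (_* 2) B) ≡ᵇ m) H
  ≡⟨ tally-cong (universal (λ B → trans (cong (λ s → t + s ≡ᵇ m) (sum-map-*ʳ 2 B))
                                        (double-offset-test t (sum B) m)) (sublists H)) ⟩
    count (λ B → c ∧ (sum B ≡ᵇ (m ∸ t) / 2)) H
  ≡⟨ tally-guard c (λ B → sum B ≡ᵇ (m ∸ t) / 2) (sublists H) ⟩
    (if c then count (λ B → sum B ≡ᵇ (m ∸ t) / 2) H else 0) ∎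
  where
  H : List ℕ
  H = applyUpTo suc (K / 2)
  c : Bool
  c = (t ≤ᵇ m) ∧ ((m ∸ t) % 2 ≡ᵇ 0)

sum-count-beyond : (g : ℕ → Bool) (m : ℕ) → (∀ k → m < k → g k ≡ false) →
                   {ys : List ℕ} → All (m <_) ys → count (g ∘ sum) ys ≡ count (g ∘ sum) []
sum-count-beyond g m vanish [] = refl
sum-count-beyond g m vanish {y ∷ ys} (m<y ∷ big) = begin
    count (g ∘ sum) (y ∷ ys)
  ≡⟨ count-∷ (g ∘ sum) y ys ⟩
    count (λ s → g (y + sum s)) ys + count (g ∘ sum) ys
  ≡⟨ cong₂ _+_ (tally-none (sublists ys) (λ s → vanish (y + sum s) (<-≤-trans m<y (m≤m+n y (sum s)))))
               (sum-count-beyond g m vanish big) ⟩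
    count (g ∘ sum) [] ∎

sum-count-stable : (g : ℕ → Bool) (m : ℕ) → (∀ k → m < k → g k ≡ false) →
                   (xs : List ℕ) {ys : List ℕ} → All (m <_) ys →
                   count (g ∘ sum) (xs ++ ys) ≡ count (g ∘ sum) xs
sum-count-stable g m vanish [] big = sum-count-beyond g m vanish big
sum-count-stable g m vanish (x ∷ xs) {ys} big = begin
    count (g ∘ sum) (x ∷ xs ++ ys)
  ≡⟨ count-∷ (g ∘ sum) x (xs ++ ys) ⟩
    count (λ s → g (x + sum s)) (xs ++ ys) + count (g ∘ sum) (xs ++ ys)
  ≡⟨ cong₂ _+_ (sum-count-stable (λ k → g (x + k)) m
                  (λ k m<k → vanish (x + k) (<-≤-trans m<k (m≤n+m k x))) xs big)
               (sum-count-stable g m vanish xs big) ⟩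
    count (λ s → g (x + sum s)) xs + count (g ∘ sum) xs
  ≡⟨ sym (count-∷ (g ∘ sum) x xs) ⟩
    count (g ∘ sum) (x ∷ xs) ∎

D₁-stable : (z K : ℕ) → z ≤ K → count (λ s → sum s ≡ᵇ z) (applyUpTo suc K) ≡ D₁ z
D₁-stable z K z≤K = begin
    count (λ s → sum s ≡ᵇ z) (applyUpTo suc K)
  ≡⟨ cong (count (λ s → sum s ≡ᵇ z) ∘ applyUpTo suc) (sym (m+[n∸m]≡n z≤K)) ⟩
    count (λ s → sum s ≡ᵇ z) (applyUpTo suc (z + (K ∸ z)))
  ≡⟨ cong (count (λ s → sum s ≡ᵇ z)) (applyUpTo-+ suc z (K ∸ z)) ⟩
    count (λ s → sum s ≡ᵇ z) (applyUpTo suc z ++ applyUpTo (λ i → suc (z + i)) (K ∸ z))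
  ≡⟨ sum-count-stable (_≡ᵇ z) z (λ k z<k → dec-false (k ≟ z) (λ k≡z → <⇒≢ z<k (sym k≡z)))
                      (applyUpTo suc z) (applyUpTo⁺₁ _ (K ∸ z) (λ {i} _ → s≤s (m≤m+n z i))) ⟩
    D₁ z ∎

gauss : (j : ℕ) → sum (applyUpTo suc j) * 2 ≡ j * suc j
gauss zero = refl
gauss (suc j) = begin
    sum (applyUpTo suc (suc j)) * 2
  ≡⟨ cong (λ xs → sum xs * 2) (sym (applyUpTo-∷ʳ suc j)) ⟩
    sum (applyUpTo suc j ∷ʳ suc j) * 2
  ≡⟨ cong (_* 2) (sum-∷ʳ (applyUpTo suc j) (suc j)) ⟩
    (sum (applyUpTo suc j) + suc j) * 2
  ≡⟨ *-distribʳ-+ 2 (sum (applyUpTo suc j)) (suc j) ⟩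
    sum (applyUpTo suc j) * 2 + suc j * 2
  ≡⟨ cong (_+ suc j * 2) (trans (gauss j) (*-comm j (suc j))) ⟩
    suc j * j + suc j * 2
  ≡⟨ sym (*-distribˡ-+ (suc j) j 2) ⟩
    suc j * (j + 2)
  ≡⟨ cong (suc j *_) (+-comm j 2) ⟩
    suc j * suc (suc j) ∎

tri-sum : (j : ℕ) → tri j ≡ sum (applyUpTo suc j)
tri-sum j = trans (cong (_/ 2) (sym (gauss j))) (m*n/n≡m (sum (applyUpTo suc j)) 2)

-- a sum of j positive terms is at least j
j≤tri : (j : ℕ) → j ≤ tri j
j≤tri j = subst₂ _≤_ (length-applyUpTo suc j) (sym (tri-sum j))
                 (length≤sum (applyUpTo⁺₁ suc j (λ _ → s≤s z≤n)))

term-beyond : (n j : ℕ) → n < j → term n j ≡ 0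
term-beyond n j n<j =
  cong (λ b → if b ∧ ((n ∸ tri j) % 2 ≡ᵇ 0) then D₁ ((n ∸ tri j) / 2) else 0) tri-too-big
  where
  tri-too-big : (tri j ≤ᵇ n) ≡ false
  tri-too-big = dec-false (tri j ≤? n) (<⇒≱ (<-≤-trans n<j (j≤tri j)))

run-fibre : (n j : ℕ) →
  count (λ B → all isEvenᵇ B ∧ (sum (applyUpTo suc j) + sum B ≡ᵇ n)) (applyUpTo suc n) ≡ term n j
run-fibre n j = begin
    count (λ B → all isEvenᵇ B ∧ (sum (applyUpTo suc j) + sum B ≡ᵇ n)) (applyUpTo suc n)
  ≡⟨ cong (λ t → count (λ B → all isEvenᵇ B ∧ (t + sum B ≡ᵇ n)) (applyUpTo suc n)) (sym (tri-sum j)) ⟩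
    count (λ B → all isEvenᵇ B ∧ (tri j + sum B ≡ᵇ n)) (applyUpTo suc n)
  ≡⟨ even-parts-count n (tri j) n ⟩
    (if c then count (λ B → sum B ≡ᵇ z) (applyUpTo suc (n / 2)) else 0)
  ≡⟨ cong (λ x → if c then x else 0) (D₁-stable z (n / 2) (/-monoˡ-≤ 2 (m∸n≤m n (tri j)))) ⟩
    term n j ∎
  where
  c : Bool
  c = (tri j ≤ᵇ n) ∧ ((n ∸ tri j) % 2 ≡ᵇ 0)
  z : ℕ
  z = (n ∸ tri j) / 2

D₂*-pairs : ℕ → List ℕ → List ℕ → Bool
D₂*-pairs n Z O = gapFree Z ∧ (all isEvenᵇ O ∧ (sum Z + sum O ≡ᵇ n))

sum-by-color : (s : List ColoredPart) →
               sum (map proj₁ s) ≡ sum (colorZeroValues s) + sum (colorOneValues s)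
sum-by-color [] = refl
sum-by-color ((v , zero) ∷ s) =
  trans (cong (v +_) (sum-by-color s)) (sym (+-assoc v _ _))
sum-by-color ((v , suc _) ∷ s) =
  trans (cong (v +_) (sum-by-color s)) (x∙yz≈y∙xz v (sum (colorZeroValues s)) _)

color1Even-ones : (s : List ColoredPart) → All (λ p → proj₂ p ≤ 1) s →
                  color1Even s ≡ all isEvenᵇ (colorOneValues s)
color1Even-ones [] [] = refl
color1Even-ones ((v , zero) ∷ s) (_ ∷ ok) = color1Even-ones s ok
color1Even-ones ((v , suc zero) ∷ s) (_ ∷ ok) = cong (isEvenᵇ v ∧_) (color1Even-ones s ok)
color1Even-ones ((v , suc (suc _)) ∷ s) (s≤s () ∷ _)

twoColored-colors : (vs : List ℕ) → All (λ p → proj₂ p ≤ 1) (twoColored vs)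
twoColored-colors [] = []
twoColored-colors (v ∷ vs) = z≤n ∷ s≤s z≤n ∷ twoColored-colors vs

D₂*-as-pairs : (n : ℕ) →
  D₂* n ≡ count (λ s → D₂*-pairs n (colorZeroValues s) (colorOneValues s)) (coloredParts n)
D₂*-as-pairs n = tally-cong (All.map (rephrase _) (sublists-All (twoColored-colors (applyUpTo suc n))))
  where
  rephrase : (s : List ColoredPart) → All (λ p → proj₂ p ≤ 1) s →
             isD₂*ᵇ n s ≡ D₂*-pairs n (colorZeroValues s) (colorOneValues s)
  rephrase s ok = begin
      (sum (map proj₁ s) ≡ᵇ n) ∧ gapFree Z ∧ color1Even s
    ≡⟨ cong₂ (λ total even → (total ≡ᵇ n) ∧ gapFree Z ∧ even) (sum-by-color s) (color1Even-ones s ok) ⟩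
      (sum Z + sum O ≡ᵇ n) ∧ gapFree Z ∧ all isEvenᵇ O
    ≡⟨ ∧-comm (sum Z + sum O ≡ᵇ n) _ ⟩
      (gapFree Z ∧ all isEvenᵇ O) ∧ (sum Z + sum O ≡ᵇ n)
    ≡⟨ ∧-assoc (gapFree Z) _ _ ⟩
      D₂*-pairs n Z O ∎
    where
    Z O : List ℕ
    Z = colorZeroValues s
    O = colorOneValues s

-- the infinite sum is realised as any partial sum over j < N with N > n
proposition2 : (n N : ℕ) → n < N → partialSum n N ≡ D₂* n
proposition2 n N n<N = begin
    partialSum n N
  ≡⟨ cong sum (map-applyUpTo (λ j → j) (term n) N) ⟩
    sum (applyUpTo (term n) N)
  ≡⟨ sum-applyUpTo-truncate (term n) n<N (term-beyond n) ⟩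
    sum (applyUpTo (term n) (suc n))
  ≡⟨ cong sum (applyUpTo-cong (λ j → sym (run-fibre n j)) (suc n)) ⟩
    sum (applyUpTo (λ j → color1Count (applyUpTo suc j)) (suc n))
  ≡⟨ sym (sum-over-runs suc suc-injective color1Count n) ⟩
    Σsub (λ Z → if gapFree Z then color1Count Z else 0) [1⋯n]
  ≡⟨ sym (Σsub-cong (λ Z → tally-guard (gapFree Z) (color1Test Z) (sublists [1⋯n])) [1⋯n]) ⟩
    Σsub (λ Z → count (D₂*-pairs n Z) [1⋯n]) [1⋯n]
  ≡⟨ sym (color-split (D₂*-pairs n) [1⋯n]) ⟩
    count (λ s → D₂*-pairs n (colorZeroValues s) (colorOneValues s)) (coloredParts n)
  ≡⟨ sym (D₂*-as-pairs n) ⟩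
    D₂* n ∎
  where
  [1⋯n] : List ℕ
  [1⋯n] = applyUpTo suc n
  color1Test : List ℕ → List ℕ → Bool
  color1Test Z O = all isEvenᵇ O ∧ (sum Z + sum O ≡ᵇ n)
  color1Count : List ℕ → ℕ
  color1Count Z = count (color1Test Z) [1⋯n]
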